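{- For every integer $\ell\geq1$ we have $\mathcal C_\ell=\mathcal C_\ell^\ast$, where \[ \mathcal C_\ell := \frac{2^{1-2\ell}(\ell-1)!}{\Gamma\left(\frac{\ell+1}{2}\right)^2},\qquad \mathcal C_{\ell}^\ast := \begin{cases} (-1)^{\frac{\ell-1}{2}} \dfrac{B_{\ell-1}^{(\ell)}\left(\frac{\ell}{2}\right)}{2(\ell-1)!} & \text{if $\ell$ is odd},\\[2ex] (-1)^{\frac{\ell}{2}+1}\dfrac{1}{2\pi} \dfrac{B_{\ell-2}^{(\ell)}\left(\frac{\ell}{2}\right)}{(\ell-2)!} & \text{if $\ell$ is even}. \end{cases} \]
   Context: $B_n^{(r)}(x)$ denotes the Bernoulli polynomial of order $r\in\mathbb N$, defined by $\left(\frac{w}{e^w-1}\right)^r e^{xw}=\sum_{n\ge0}B_n^{(r)}(x)\frac{w^n}{n!}$. -}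

module Defs where

open import Data.Nat as ℕ using (ℕ; zero; suc; _!; _∸_; _%_)
import Data.Nat.DivMod
open import Data.Integer as ℤ using (ℤ; +_; +[1+_]; -[1+_])
open import Data.Rational as ℚ using (ℚ; mkℚ; 0ℚ; 1ℚ; _+_; _*_; -_; 1/_)
open import Data.List using (List; []; _∷_; map; zipWith; foldr)
open import Data.List using (upTo)

ℕ→ℚ : ℕ → ℚ
ℕ→ℚ n = (+ n) ℚ./ 1

-- total reciprocal (0 ↦ 0); only ever applied to nonzero values below
inv : ℚ → ℚ
inv (mkℚ (+ zero) _ _) = 0ℚ
inv p@(mkℚ +[1+ _ ] _ _) = 1/ p
inv p@(mkℚ -[1+ _ ] _ _) = 1/ p

_÷ℚ_ : ℚ → ℚ → ℚ
p ÷ℚ q = p * inv q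

_^ℚ_ : ℚ → ℕ → ℚ
q ^ℚ zero = 1ℚ
q ^ℚ suc n = q * (q ^ℚ n)

sgn : ℕ → ℚ
sgn n = (- 1ℚ) ^ℚ n

sumℚ : List ℚ → ℚ
sumℚ = foldr _+_ 0ℚ

Σ≤ : ℕ → (ℕ → ℚ) → ℚ
Σ≤ zero f = f 0
Σ≤ (suc n) f = Σ≤ n f + f (suc n)

-- Formal power series over ℚ, represented by their coefficient sequences

Series : Set
Series = ℕ → ℚ

_⊛_ : Series → Series → Series
(f ⊛ g) n = Σ≤ n (λ k → f k * g (n ∸ k))

_^S_ : Series → ℕ → Series
f ^S zero = λ { zero → 1ℚ ; (suc _) → 0ℚ }
f ^S suc r = f ⊛ (f ^S r)

-- (e^w - 1)/w = Σ w^n/(n+1)!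
expm1/w : Series
expm1/w n = inv (ℕ→ℚ (suc n !))

-- reversed list [a_n, …, a_0] of coefficients of w/(e^w-1),
-- the multiplicative inverse of expm1/w (whose constant term is 1):
-- a_0 = 1, a_n = - Σ_{k=1}^{n} g_k a_{n-k}
invCoeffs : ℕ → List ℚ
invCoeffs zero = 1ℚ ∷ []
invCoeffs (suc n) =
  (- sumℚ (zipWith _*_ (map (λ k → expm1/w (suc k)) (upTo (suc n))) prev)) ∷ prev
  where prev = invCoeffs n

headℚ : List ℚ → ℚ
headℚ [] = 0ℚ
headℚ (x ∷ _) = x

w/expm1 : Series
w/expm1 n = headℚ (invCoeffs n)

-- e^{xw} = Σ x^n w^n / n!
expS : ℚ → Series
expS x n = (x ^ℚ n) ÷ℚ ℕ→ℚ (n !)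

-- Bernoulli polynomial of order r:
-- (w/(e^w-1))^r e^{xw} = Σ B_n^{(r)}(x) w^n/n!
bernoulliPoly : (r n : ℕ) → ℚ → ℚ
bernoulliPoly r n x = ℕ→ℚ (n !) * (((w/expm1 ^S r) ⊛ expS x) n)

-- Numbers of the form  q · π^e  (q ∈ ℚ, e ∈ ℤ), i.e. monomials in ℚ(π).
-- All values occurring below are nonzero, so equality of such monomials
-- (π being transcendental) is equality of both components.

record Qπ : Set where
  constructor _·π^_
  field
    coeff : ℚ
    piExp : ℤ

open Qπ public

-- Γ(m/2)^2 for m ≥ 1, using Γ(1/2)^2 = π, Γ(1)^2 = 1 and Γ(s+1) = s Γ(s).
-- (Value at m = 0 is irrelevant and set to 0.)
Γ²-half : ℕ → Qπ
Γ²-half zero = 0ℚ ·π^ (+ 0)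
Γ²-half (suc zero) = 1ℚ ·π^ (+ 1)
Γ²-half (suc (suc zero)) = 1ℚ ·π^ (+ 0)
Γ²-half (suc (suc (suc m))) with Γ²-half (suc m)
... | q ·π^ e = (((ℕ→ℚ (suc m) * ℚ.½) ^ℚ 2) * q) ·π^ e

𝒞 : ℕ → Qπ
𝒞 ℓ with Γ²-half (suc ℓ)
... | q ·π^ e = ((2ℚ * inv (ℕ→ℚ 4 ^ℚ ℓ)) * ℕ→ℚ ((ℓ ∸ 1) !) ÷ℚ q) ·π^ (ℤ.- e)
  where 2ℚ = ℕ→ℚ 2

𝒞* : ℕ → Qπ
𝒞* ℓ with ℓ % 2
... | 1 = (sgn ((ℓ ∸ 1) Data.Nat.DivMod./ 2)
            * (bernoulliPoly ℓ (ℓ ∸ 1) (ℕ→ℚ ℓ * ℚ.½)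
               ÷ℚ (ℕ→ℚ 2 * ℕ→ℚ ((ℓ ∸ 1) !)))) ·π^ (+ 0)
... | _ = (sgn (suc (ℓ Data.Nat.DivMod./ 2)) * ℚ.½
            * (bernoulliPoly ℓ (ℓ ∸ 2) (ℕ→ℚ ℓ * ℚ.½)
               ÷ℚ ℕ→ℚ ((ℓ ∸ 2) !))) ·π^ (-[1+ 0 ])

{-# OPTIONS --safe #-}

-- Let H = w e^{w/2}/(e^w − 1) = (w/2)/sinh(w/2), so that B_n^{(l)}(l/2)/n! is the coefficient of w^n in H^l.
-- From H · 2 sinh(w/2) = w one gets, for θ = w d/dw and P = (w/2) coth(w/2) = H cosh(w/2),
--   θH = H − HP,   θP = P − P² + w²/4,   P² − w²/4 = H²,
-- and hence the differential equation l(l+1) H^{l+2} = (θ − l − 1)(θ − l) H^l − (l²/4) w² H^l.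
-- At w^{n+2} with n + 2 ∈ {l, l + 1} the first term vanishes, so the coefficients defining 𝒞*_l satisfy
-- 4(l+1) 𝒞*_{l+2} = l 𝒞*_l. The functional equation Γ(s+1) = sΓ(s) gives the same recurrence for 𝒞_l,
-- and the two sides agree at l = 1 and l = 2.

module Submission where

open import Defs
open import Data.Nat using (ℕ; _≥_)
open import Relation.Binary.PropositionalEquality using (_≡_)

open import Data.Nat as ℕ using (zero; suc; _!; _∸_; _≤_; z≤n; s≤s; _%_; _/_)
import Data.Nat.Properties as ℕP
import Data.Nat.DivMod as ℕD
import Data.Nat.Coprimality as Coprimality
open import Data.Integer as ℤ using (+_; -[1+_])
import Data.Integer.Properties as ℤP
import Data.Integer.Solver as ℤ-Solver
open import Data.Rational as ℚ using (ℚ; mkℚ; 0ℚ; 1ℚ; _+_; _*_; -_; _-_; ½; -½)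
import Data.Rational.Properties as ℚP
import Data.Rational.Unnormalised as ℚᵘ
import Data.Rational.Unnormalised.Properties as ℚᵘP
import Data.Rational.Solver as ℚ-Solver
open import Data.List using (_∷_; map; zipWith; applyUpTo; upTo)
open import Data.Maybe using (Maybe; just; nothing)
open import Data.Product using (_,_)
open import Data.Sum using (_⊎_; inj₁; inj₂)
open import Relation.Nullary using (yes; no)
open import Relation.Binary.PropositionalEquality
  using (_≢_; refl; sym; trans; cong; cong₂; module ≡-Reasoning)
open import Algebra.Bundles using (CommutativeRing)
import Algebra.Solver.Ring
import Algebra.Solver.Ring.AlmostCommutativeRing as ACR
import Relation.Binary.Reasoning.Setoid as SetoidReasoning

module _ where
  open ≡-Reasoning
  open ℚ-Solver.+-*-Solver

  inv-inverseˡ : ∀ p → p ≢ 0ℚ → inv p * p ≡ 1ℚ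
  inv-inverseˡ (mkℚ (+ zero) _ _) p≢0 with () ← p≢0 (ℚP.↥p≡0⇒p≡0 _ refl)
  inv-inverseˡ p@(mkℚ ℤ.+[1+ _ ] _ _) _ = ℚP.*-inverseˡ p
  inv-inverseˡ p@(mkℚ ℤ.-[1+ _ ] _ _) _ = ℚP.*-inverseˡ p

  inv-inverseʳ : ∀ p → p ≢ 0ℚ → p * inv p ≡ 1ℚ
  inv-inverseʳ p p≢0 = trans (ℚP.*-comm p (inv p)) (inv-inverseˡ p p≢0)

  *-cancelˡ : ∀ x {a b} → x ≢ 0ℚ → x * a ≡ x * b → a ≡ b
  *-cancelˡ x {a} {b} x≢0 eq = begin
    a                 ≡⟨ ℚP.*-identityˡ a ⟨
    1ℚ * a            ≡⟨ cong (_* a) (sym (inv-inverseˡ x x≢0)) ⟩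
    (inv x * x) * a   ≡⟨ ℚP.*-assoc (inv x) x a ⟩
    inv x * (x * a)   ≡⟨ cong (inv x *_) eq ⟩
    inv x * (x * b)   ≡⟨ ℚP.*-assoc (inv x) x b ⟨
    (inv x * x) * b   ≡⟨ cong (_* b) (inv-inverseˡ x x≢0) ⟩
    1ℚ * b            ≡⟨ ℚP.*-identityˡ b ⟩
    b                 ∎

  inv-unique : ∀ p q → p * q ≡ 1ℚ → inv p ≡ q
  inv-unique p q pq≡1 = *-cancelˡ p p≢0 (trans (inv-inverseʳ p p≢0) (sym pq≡1))
    where
    p≢0 : p ≢ 0ℚ
    p≢0 refl = ℚP.1≢0 (trans (sym pq≡1) (ℚP.*-zeroˡ q))

  inv-distrib-* : ∀ p q → inv (p * q) ≡ inv p * inv q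
  inv-distrib-* p q with p ℚ.≟ 0ℚ | q ℚ.≟ 0ℚ
  ... | yes refl | _ = trans (cong inv (ℚP.*-zeroˡ q)) (sym (ℚP.*-zeroˡ (inv q)))
  ... | no _ | yes refl = trans (cong inv (ℚP.*-zeroʳ p)) (sym (ℚP.*-zeroʳ (inv p)))
  ... | no p≢0 | no q≢0 = inv-unique (p * q) (inv p * inv q) (begin
    (p * q) * (inv p * inv q)    ≡⟨ solve 4 (λ a b c d → (a :* b) :* (c :* d) := (a :* c) :* (b :* d)) refl p q (inv p) (inv q) ⟩
    (p * inv p) * (q * inv q)    ≡⟨ cong₂ _*_ (inv-inverseʳ p p≢0) (inv-inverseʳ q q≢0) ⟩
    1ℚ                           ∎)

module _ where

  ℕ→ℚ≡mkℚ : ∀ n → ℕ→ℚ n ≡ mkℚ (+ n) 0 (Coprimality.sym (Coprimality.1-coprimeTo n))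
  ℕ→ℚ≡mkℚ n = ℚP.normalize-coprime (Coprimality.sym (Coprimality.1-coprimeTo n))

  ℕ→ℚ-≢0 : ∀ n → .{{ℕ.NonZero n}} → ℕ→ℚ n ≢ 0ℚ
  ℕ→ℚ-≢0 n eq = ℕ.≢-nonZero⁻¹ n (ℤP.+-injective (cong ℚ.↥_ (trans (sym (ℕ→ℚ≡mkℚ n)) eq)))

  private
    toℚᵘ-ℕ→ℚ : ∀ n → ℚ.toℚᵘ (ℕ→ℚ n) ≡ ℚᵘ.mkℚᵘ (+ n) 0
    toℚᵘ-ℕ→ℚ n = cong ℚ.toℚᵘ (ℕ→ℚ≡mkℚ n)

    ℕ→ℚ-homo : (_∙_ : ℕ → ℕ → ℕ) (_∘_ : ℚ → ℚ → ℚ) (_∘ᵘ_ : ℚᵘ.ℚᵘ → ℚᵘ.ℚᵘ → ℚᵘ.ℚᵘ) →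
               (∀ p q → ℚ.toℚᵘ (p ∘ q) ℚᵘ.≃ (ℚ.toℚᵘ p ∘ᵘ ℚ.toℚᵘ q)) →
               (∀ m n → ℚᵘ.mkℚᵘ (+ (m ∙ n)) 0 ℚᵘ.≃ (ℚᵘ.mkℚᵘ (+ m) 0 ∘ᵘ ℚᵘ.mkℚᵘ (+ n) 0)) →
               ∀ m n → ℕ→ℚ (m ∙ n) ≡ ℕ→ℚ m ∘ ℕ→ℚ n
    ℕ→ℚ-homo _∙_ _∘_ _∘ᵘ_ homo onMkℚᵘ m n = ℚP.toℚᵘ-injective (begin
      ℚ.toℚᵘ (ℕ→ℚ (m ∙ n))                ≡⟨ toℚᵘ-ℕ→ℚ (m ∙ n) ⟩
      ℚᵘ.mkℚᵘ (+ (m ∙ n)) 0               ≈⟨ onMkℚᵘ m n ⟩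
      ℚᵘ.mkℚᵘ (+ m) 0 ∘ᵘ ℚᵘ.mkℚᵘ (+ n) 0  ≡⟨ cong₂ _∘ᵘ_ (toℚᵘ-ℕ→ℚ m) (toℚᵘ-ℕ→ℚ n) ⟨
      ℚ.toℚᵘ (ℕ→ℚ m) ∘ᵘ ℚ.toℚᵘ (ℕ→ℚ n)   ≈⟨ homo (ℕ→ℚ m) (ℕ→ℚ n) ⟨
      ℚ.toℚᵘ (ℕ→ℚ m ∘ ℕ→ℚ n)             ∎)
      where open ℚᵘP.≃-Reasoning

  ℕ→ℚ-+ : ∀ m n → ℕ→ℚ (m ℕ.+ n) ≡ ℕ→ℚ m + ℕ→ℚ n
  ℕ→ℚ-+ = ℕ→ℚ-homo ℕ._+_ _+_ ℚᵘ._+_ ℚP.toℚᵘ-homo-+ λ m n → ℚᵘ.*≡* (begin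
    + (m ℕ.+ n) ℤ.* + 1                          ≡⟨ cong (ℤ._* + 1) (ℤP.pos-+ m n) ⟩
    (+ m ℤ.+ + n) ℤ.* + 1                        ≡⟨ solve 2 (λ a b → (a :+ b) :* con (+ 1) := (a :* con (+ 1) :+ b :* con (+ 1)) :* con (+ 1)) refl (+ m) (+ n) ⟩
    (+ m ℤ.* + 1 ℤ.+ + n ℤ.* + 1) ℤ.* + 1        ∎)
    where
    open ≡-Reasoning
    open ℤ-Solver.+-*-Solver

  ℕ→ℚ-* : ∀ m n → ℕ→ℚ (m ℕ.* n) ≡ ℕ→ℚ m * ℕ→ℚ n
  ℕ→ℚ-* = ℕ→ℚ-homo ℕ._*_ _*_ ℚᵘ._*_ ℚP.toℚᵘ-homo-* λ m n → ℚᵘ.*≡* (begin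
    + (m ℕ.* n) ℤ.* + 1     ≡⟨ cong (ℤ._* + 1) (ℤP.pos-* m n) ⟩
    (+ m ℤ.* + n) ℤ.* + 1   ∎)
    where open ≡-Reasoning

  ℕ→ℚ-suc : ∀ n → ℕ→ℚ (suc n) ≡ 1ℚ + ℕ→ℚ n
  ℕ→ℚ-suc = ℕ→ℚ-+ 1

module _ where
  open ≡-Reasoning

  Σ≤-cong : ∀ n {f g : ℕ → ℚ} → (∀ k → k ≤ n → f k ≡ g k) → Σ≤ n f ≡ Σ≤ n g
  Σ≤-cong zero f≗g = f≗g 0 z≤n
  Σ≤-cong (suc n) f≗g =
    cong₂ _+_ (Σ≤-cong n (λ k k≤n → f≗g k (ℕP.m≤n⇒m≤1+n k≤n))) (f≗g (suc n) ℕP.≤-refl)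

  Σ≤-ext : ∀ n {f g : ℕ → ℚ} → (∀ k → f k ≡ g k) → Σ≤ n f ≡ Σ≤ n g
  Σ≤-ext n f≗g = Σ≤-cong n (λ k _ → f≗g k)

  Σ≤-+ : ∀ n (f g : ℕ → ℚ) → Σ≤ n (λ k → f k + g k) ≡ Σ≤ n f + Σ≤ n g
  Σ≤-+ zero f g = refl
  Σ≤-+ (suc n) f g = begin
    Σ≤ n (λ k → f k + g k) + (f (suc n) + g (suc n))  ≡⟨ cong (_+ (f (suc n) + g (suc n))) (Σ≤-+ n f g) ⟩
    (Σ≤ n f + Σ≤ n g) + (f (suc n) + g (suc n))       ≡⟨ solve 4 (λ a b c d → (a :+ b) :+ (c :+ d) := (a :+ c) :+ (b :+ d)) refl (Σ≤ n f) (Σ≤ n g) (f (suc n)) (g (suc n)) ⟩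
    (Σ≤ n f + f (suc n)) + (Σ≤ n g + g (suc n))       ∎
    where open ℚ-Solver.+-*-Solver

  Σ≤-*ˡ : ∀ n c (f : ℕ → ℚ) → Σ≤ n (λ k → c * f k) ≡ c * Σ≤ n f
  Σ≤-*ˡ zero c f = refl
  Σ≤-*ˡ (suc n) c f =
    trans (cong (_+ c * f (suc n)) (Σ≤-*ˡ n c f)) (sym (ℚP.*-distribˡ-+ c (Σ≤ n f) (f (suc n))))

  Σ≤-*ʳ : ∀ n c (f : ℕ → ℚ) → Σ≤ n (λ k → f k * c) ≡ Σ≤ n f * c
  Σ≤-*ʳ n c f = begin
    Σ≤ n (λ k → f k * c)  ≡⟨ Σ≤-ext n (λ k → ℚP.*-comm (f k) c) ⟩
    Σ≤ n (λ k → c * f k)  ≡⟨ Σ≤-*ˡ n c f ⟩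
    c * Σ≤ n f            ≡⟨ ℚP.*-comm c (Σ≤ n f) ⟩
    Σ≤ n f * c            ∎

  Σ≤-0 : ∀ n → Σ≤ n (λ _ → 0ℚ) ≡ 0ℚ
  Σ≤-0 zero = refl
  Σ≤-0 (suc n) = cong (_+ 0ℚ) (Σ≤-0 n)

  Σ≤-suc : ∀ n (f : ℕ → ℚ) → Σ≤ (suc n) f ≡ f 0 + Σ≤ n (λ k → f (suc k))
  Σ≤-suc zero f = refl
  Σ≤-suc (suc n) f = trans (cong (_+ f (suc (suc n))) (Σ≤-suc n f)) (ℚP.+-assoc (f 0) _ _)

  Σ≤-reverse : ∀ n (f : ℕ → ℚ) → Σ≤ n f ≡ Σ≤ n (λ k → f (n ∸ k))
  Σ≤-reverse zero f = refl
  Σ≤-reverse (suc n) f = begin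
    Σ≤ n f + f (suc n)                   ≡⟨ cong (_+ f (suc n)) (Σ≤-reverse n f) ⟩
    Σ≤ n (λ k → f (n ∸ k)) + f (suc n)   ≡⟨ ℚP.+-comm _ (f (suc n)) ⟩
    f (suc n) + Σ≤ n (λ k → f (n ∸ k))   ≡⟨ Σ≤-suc n (λ k → f (suc n ∸ k)) ⟨
    Σ≤ (suc n) (λ k → f (suc n ∸ k))     ∎

  Σ≤-swap : ∀ n (F : ℕ → ℕ → ℚ) →
            Σ≤ n (λ k → Σ≤ k (λ i → F i k)) ≡ Σ≤ n (λ i → Σ≤ (n ∸ i) (λ j → F i (i ℕ.+ j)))
  Σ≤-swap zero F = refl
  Σ≤-swap (suc n) F = begin
    Σ≤ n (λ k → Σ≤ k (λ i → F i k)) + (column + F (suc n) (suc n))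
      ≡⟨ cong (_+ (column + F (suc n) (suc n))) (Σ≤-swap n F) ⟩
    Σ≤ n (row n) + (column + F (suc n) (suc n))
      ≡⟨ ℚP.+-assoc (Σ≤ n (row n)) column (F (suc n) (suc n)) ⟨
    (Σ≤ n (row n) + column) + F (suc n) (suc n)
      ≡⟨ cong₂ _+_ (Σ≤-+ n (row n) (λ i → F i (suc n))) lastRow ⟨
    Σ≤ n (λ i → row n i + F i (suc n)) + row (suc n) (suc n)
      ≡⟨ cong (_+ row (suc n) (suc n)) (Σ≤-cong n extendRow) ⟩
    Σ≤ n (row (suc n)) + row (suc n) (suc n)
      ∎
    where
    row : ℕ → ℕ → ℚ
    row m i = Σ≤ (m ∸ i) (λ j → F i (i ℕ.+ j))

    column : ℚ
    column = Σ≤ n (λ i → F i (suc n))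

    lastRow : row (suc n) (suc n) ≡ F (suc n) (suc n)
    lastRow rewrite ℕP.n∸n≡0 n = cong (F (suc n)) (ℕP.+-identityʳ (suc n))

    extendRow : ∀ i → i ≤ n → row n i + F i (suc n) ≡ row (suc n) i
    extendRow i i≤n rewrite ℕP.+-∸-assoc 1 i≤n =
      cong (λ m → row n i + F i m) (sym (trans (ℕP.+-suc i (n ∸ i)) (cong suc (ℕP.m+[n∸m]≡n i≤n))))

-- The ring of formal power series

infix 4 _≈_
_≈_ : Series → Series → Set
f ≈ g = ∀ n → f n ≡ g n

infixl 6 _⊕_ _⊖_
_⊕_ : Series → Series → Series
(f ⊕ g) n = f n + g n

⊝_ : Series → Series
(⊝ f) n = - f n

_⊖_ : Series → Series → Series
f ⊖ g = f ⊕ (⊝ g)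

κ : ℚ → Series
κ c zero = c
κ c (suc _) = 0ℚ

𝟘 : Series
𝟘 _ = 0ℚ

X : Series
X zero = 0ℚ
X (suc zero) = 1ℚ
X (suc (suc _)) = 0ℚ

module _ where
  open ≡-Reasoning

  ≈-refl : ∀ {f} → f ≈ f
  ≈-refl n = refl

  ≈-sym : ∀ {f g} → f ≈ g → g ≈ f
  ≈-sym f≈g n = sym (f≈g n)

  ≈-trans : ∀ {f g h} → f ≈ g → g ≈ h → f ≈ h
  ≈-trans f≈g g≈h n = trans (f≈g n) (g≈h n)

  ⊕-cong : ∀ {f f′ g g′} → f ≈ f′ → g ≈ g′ → f ⊕ g ≈ f′ ⊕ g′
  ⊕-cong f≈f′ g≈g′ n = cong₂ _+_ (f≈f′ n) (g≈g′ n)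

  ⊝-cong : ∀ {f g} → f ≈ g → ⊝ f ≈ ⊝ g
  ⊝-cong f≈g n = cong -_ (f≈g n)

  ⊖-cong : ∀ {f f′ g g′} → f ≈ f′ → g ≈ g′ → f ⊖ g ≈ f′ ⊖ g′
  ⊖-cong f≈f′ g≈g′ = ⊕-cong f≈f′ (⊝-cong g≈g′)

  ⊛-cong : ∀ {f f′ g g′} → f ≈ f′ → g ≈ g′ → f ⊛ g ≈ f′ ⊛ g′
  ⊛-cong f≈f′ g≈g′ n = Σ≤-ext n (λ k → cong₂ _*_ (f≈f′ k) (g≈g′ (n ∸ k)))

  ⊛-congˡ : ∀ {f f′} g → f ≈ f′ → f ⊛ g ≈ f′ ⊛ g
  ⊛-congˡ g f≈f′ = ⊛-cong f≈f′ (≈-refl {g})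

  ⊛-congʳ : ∀ f {g g′} → g ≈ g′ → f ⊛ g ≈ f ⊛ g′
  ⊛-congʳ f g≈g′ = ⊛-cong (≈-refl {f}) g≈g′

  ⊛-comm : ∀ f g → f ⊛ g ≈ g ⊛ f
  ⊛-comm f g n = trans (Σ≤-reverse n _) (Σ≤-cong n λ k k≤n →
    trans (ℚP.*-comm (f (n ∸ k)) _) (cong (λ m → g m * f (n ∸ k)) (ℕP.m∸[m∸n]≡n k≤n)))

  ⊛-assoc : ∀ f g h → (f ⊛ g) ⊛ h ≈ f ⊛ (g ⊛ h)
  ⊛-assoc f g h n = begin
    Σ≤ n (λ k → Σ≤ k (λ i → f i * g (k ∸ i)) * h (n ∸ k))
      ≡⟨ Σ≤-ext n (λ k → Σ≤-*ʳ k (h (n ∸ k)) (λ i → f i * g (k ∸ i))) ⟨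
    Σ≤ n (λ k → Σ≤ k (λ i → f i * g (k ∸ i) * h (n ∸ k)))
      ≡⟨ Σ≤-swap n (λ i k → f i * g (k ∸ i) * h (n ∸ k)) ⟩
    Σ≤ n (λ i → Σ≤ (n ∸ i) (λ j → f i * g (i ℕ.+ j ∸ i) * h (n ∸ (i ℕ.+ j))))
      ≡⟨ Σ≤-ext n (λ i → trans (Σ≤-ext (n ∸ i) (reindex i)) (Σ≤-*ˡ (n ∸ i) (f i) _)) ⟩
    Σ≤ n (λ i → f i * Σ≤ (n ∸ i) (λ j → g j * h (n ∸ i ∸ j)))
      ∎
    where
    reindex : ∀ i j → f i * g (i ℕ.+ j ∸ i) * h (n ∸ (i ℕ.+ j)) ≡ f i * (g j * h (n ∸ i ∸ j))
    reindex i j = trans (cong₂ (λ a b → f i * g a * h b) (ℕP.m+n∸m≡n i j) (sym (ℕP.∸-+-assoc n i j)))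
                        (ℚP.*-assoc (f i) (g j) (h (n ∸ i ∸ j)))

  ⊛-distribˡ : ∀ f g h → f ⊛ (g ⊕ h) ≈ (f ⊛ g) ⊕ (f ⊛ h)
  ⊛-distribˡ f g h n = trans (Σ≤-ext n (λ k → ℚP.*-distribˡ-+ (f k) (g (n ∸ k)) (h (n ∸ k)))) (Σ≤-+ n _ _)

  ⊛-distribʳ : ∀ f g h → (g ⊕ h) ⊛ f ≈ (g ⊛ f) ⊕ (h ⊛ f)
  ⊛-distribʳ f g h n = trans (Σ≤-ext n (λ k → ℚP.*-distribʳ-+ (f (n ∸ k)) (g k) (h k))) (Σ≤-+ n _ _)

  κ-⊛ : ∀ c g → κ c ⊛ g ≈ λ n → c * g n
  κ-⊛ c g zero = refl
  κ-⊛ c g (suc n) = begin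
    Σ≤ (suc n) (λ k → κ c k * g (suc n ∸ k))         ≡⟨ Σ≤-suc n _ ⟩
    c * g (suc n) + Σ≤ n (λ k → 0ℚ * g (n ∸ k))      ≡⟨ cong (_+_ (c * g (suc n))) (trans (Σ≤-ext n (λ k → ℚP.*-zeroˡ (g (n ∸ k)))) (Σ≤-0 n)) ⟩
    c * g (suc n) + 0ℚ                               ≡⟨ ℚP.+-identityʳ _ ⟩
    c * g (suc n)                                    ∎

  κ-⊛-identityˡ : ∀ g → κ 1ℚ ⊛ g ≈ g
  κ-⊛-identityˡ g n = trans (κ-⊛ 1ℚ g n) (ℚP.*-identityˡ (g n))

  κ-cong : ∀ {a b} → a ≡ b → κ a ≈ κ b
  κ-cong refl = ≈-refl

  κ-+ : ∀ a b → κ (a + b) ≈ κ a ⊕ κ b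
  κ-+ a b zero = refl
  κ-+ a b (suc n) = sym (ℚP.+-identityˡ 0ℚ)

  X-⊛-zero : ∀ g → (X ⊛ g) 0 ≡ 0ℚ
  X-⊛-zero g = ℚP.*-zeroˡ (g 0)

  X-⊛-suc : ∀ g n → (X ⊛ g) (suc n) ≡ g n
  X-⊛-suc g n = begin
    Σ≤ (suc n) (λ k → X k * g (suc n ∸ k))                 ≡⟨ Σ≤-suc n _ ⟩
    0ℚ * g (suc n) + Σ≤ n (λ k → X (suc k) * g (n ∸ k))    ≡⟨ cong₂ _+_ (ℚP.*-zeroˡ (g (suc n))) (Σ≤-ext n (λ k → cong (_* g (n ∸ k)) (X-suc k))) ⟩
    0ℚ + (κ 1ℚ ⊛ g) n                                       ≡⟨ trans (ℚP.+-identityˡ _) (κ-⊛-identityˡ g n) ⟩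
    g n                                                     ∎
    where
    X-suc : ∀ k → X (suc k) ≡ κ 1ℚ k
    X-suc zero = refl
    X-suc (suc k) = refl

  X-⊛-cancel : ∀ {f g} → X ⊛ f ≈ X ⊛ g → f ≈ g
  X-⊛-cancel {f} {g} Xf≈Xg n = trans (sym (X-⊛-suc f n)) (trans (Xf≈Xg (suc n)) (X-⊛-suc g n))

Series-commutativeRing : CommutativeRing _ _
Series-commutativeRing = record
  { Carrier = Series ; _≈_ = _≈_ ; _+_ = _⊕_ ; _*_ = _⊛_ ; -_ = ⊝_ ; 0# = 𝟘 ; 1# = κ 1ℚ
  ; isCommutativeRing = record
    { isRing = record
      { +-isAbelianGroup = record
        { isGroup = record
          { isMonoid = record
            { isSemigroup = record
              { isMagma = record
                { isEquivalence = record { refl = ≈-refl ; sym = ≈-sym ; trans = ≈-trans }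
                ; ∙-cong = ⊕-cong }
              ; assoc = λ f g h n → ℚP.+-assoc (f n) (g n) (h n) }
            ; identity = (λ f n → ℚP.+-identityˡ (f n)) , (λ f n → ℚP.+-identityʳ (f n)) }
          ; inverse = (λ f n → ℚP.+-inverseˡ (f n)) , (λ f n → ℚP.+-inverseʳ (f n))
          ; ⁻¹-cong = ⊝-cong }
        ; comm = λ f g n → ℚP.+-comm (f n) (g n) }
      ; *-cong = ⊛-cong
      ; *-assoc = ⊛-assoc
      ; *-identity = κ-⊛-identityˡ , λ f → ≈-trans (⊛-comm f (κ 1ℚ)) (κ-⊛-identityˡ f)
      ; distrib = ⊛-distribˡ , ⊛-distribʳ }
    ; *-comm = ⊛-comm } }

module Series-Solver where
  private
    Series-almostCommutativeRing : ACR.AlmostCommutativeRing _ _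
    Series-almostCommutativeRing = ACR.fromCommutativeRing Series-commutativeRing

    κ-homomorphism : ℚ.+-*-rawRing ACR.-Raw-AlmostCommutative⟶ Series-almostCommutativeRing
    κ-homomorphism = record
      { ⟦_⟧ = κ
      ; +-homo = κ-+
      ; *-homo = λ a b n → sym (trans (κ-⊛ a (κ b) n) (*-κ a b n))
      ; -‿homo = λ a → λ { zero → refl ; (suc n) → refl }
      ; 0-homo = λ { zero → refl ; (suc n) → refl }
      ; 1-homo = λ { zero → refl ; (suc n) → refl } }
      where
      *-κ : ∀ a b n → a * κ b n ≡ κ (a * b) n
      *-κ a b zero = refl
      *-κ a b (suc n) = ℚP.*-zeroʳ a

    κ-≟ : ∀ a b → Maybe (ACR.Induced-equivalence κ-homomorphism a b)
    κ-≟ a b with a ℚ.≟ b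
    ... | yes refl = just ≈-refl
    ... | no _ = nothing

  open Algebra.Solver.Ring ℚ.+-*-rawRing Series-almostCommutativeRing κ-homomorphism κ-≟ public

module ≈-Reasoning = SetoidReasoning (CommutativeRing.setoid Series-commutativeRing)

-- The Euler operator θ = w d/dw

θ : Series → Series
θ f n = ℕ→ℚ n * f n

θ∸ : ℚ → Series → Series
θ∸ c f = θ f ⊖ κ c ⊛ f

module _ where
  open ≡-Reasoning

  θ-cong : ∀ {f g} → f ≈ g → θ f ≈ θ g
  θ-cong f≈g n = cong (ℕ→ℚ n *_) (f≈g n)

  θ-⊕ : ∀ f g → θ (f ⊕ g) ≈ θ f ⊕ θ g
  θ-⊕ f g n = ℚP.*-distribˡ-+ (ℕ→ℚ n) (f n) (g n)

  θ-⊝ : ∀ f → θ (⊝ f) ≈ ⊝ θ f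
  θ-⊝ f n = sym (ℚP.neg-distribʳ-* (ℕ→ℚ n) (f n))

  θ-⊖ : ∀ f g → θ (f ⊖ g) ≈ θ f ⊖ θ g
  θ-⊖ f g n = trans (θ-⊕ f (⊝ g) n) (cong (_+_ (θ f n)) (θ-⊝ g n))

  θ-κ : ∀ c → θ (κ c) ≈ 𝟘
  θ-κ c zero = ℚP.*-zeroˡ c
  θ-κ c (suc n) = ℚP.*-zeroʳ (ℕ→ℚ (suc n))

  θ-X : θ X ≈ X
  θ-X zero = refl
  θ-X (suc zero) = refl
  θ-X (suc (suc n)) = ℚP.*-zeroʳ (ℕ→ℚ (suc (suc n)))

  θ-⊛ : ∀ f g → θ (f ⊛ g) ≈ (θ f ⊛ g) ⊕ (f ⊛ θ g)
  θ-⊛ f g n = begin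
    ℕ→ℚ n * Σ≤ n (λ k → f k * g (n ∸ k))       ≡⟨ Σ≤-*ˡ n (ℕ→ℚ n) _ ⟨
    Σ≤ n (λ k → ℕ→ℚ n * (f k * g (n ∸ k)))     ≡⟨ Σ≤-cong n split ⟩
    Σ≤ n (λ k → θ f k * g (n ∸ k) + f k * θ g (n ∸ k)) ≡⟨ Σ≤-+ n _ _ ⟩
    ((θ f ⊛ g) ⊕ (f ⊛ θ g)) n                   ∎
    where
    split : ∀ k → k ≤ n → ℕ→ℚ n * (f k * g (n ∸ k)) ≡ θ f k * g (n ∸ k) + f k * θ g (n ∸ k)
    split k k≤n = begin
      ℕ→ℚ n * (f k * g (n ∸ k))                   ≡⟨ cong (λ m → ℕ→ℚ m * (f k * g (n ∸ k))) (ℕP.m+[n∸m]≡n k≤n) ⟨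
      ℕ→ℚ (k ℕ.+ (n ∸ k)) * (f k * g (n ∸ k))     ≡⟨ cong (_* (f k * g (n ∸ k))) (ℕ→ℚ-+ k (n ∸ k)) ⟩
      (ℕ→ℚ k + ℕ→ℚ (n ∸ k)) * (f k * g (n ∸ k))   ≡⟨ solve 4 (λ a b x y → (a :+ b) :* (x :* y) := a :* x :* y :+ x :* (b :* y)) refl (ℕ→ℚ k) (ℕ→ℚ (n ∸ k)) (f k) (g (n ∸ k)) ⟩
      θ f k * g (n ∸ k) + f k * θ g (n ∸ k)       ∎
      where open ℚ-Solver.+-*-Solver

  θ-κ-⊛ : ∀ c f → θ (κ c ⊛ f) ≈ κ c ⊛ θ f
  θ-κ-⊛ c f n = begin
    ℕ→ℚ n * (κ c ⊛ f) n  ≡⟨ cong (ℕ→ℚ n *_) (κ-⊛ c f n) ⟩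
    ℕ→ℚ n * (c * f n)    ≡⟨ solve 3 (λ a b x → a :* (b :* x) := b :* (a :* x)) refl (ℕ→ℚ n) c (f n) ⟩
    c * (ℕ→ℚ n * f n)    ≡⟨ κ-⊛ c (θ f) n ⟨
    (κ c ⊛ θ f) n        ∎
    where open ℚ-Solver.+-*-Solver

  θ∸-coeff : ∀ c f n → θ∸ c f n ≡ (ℕ→ℚ n - c) * f n
  θ∸-coeff c f n = begin
    ℕ→ℚ n * f n + - (κ c ⊛ f) n   ≡⟨ cong (λ x → ℕ→ℚ n * f n + - x) (κ-⊛ c f n) ⟩
    ℕ→ℚ n * f n + - (c * f n)     ≡⟨ solve 3 (λ m c x → m :* x :+ :- (c :* x) := (m :- c) :* x) refl (ℕ→ℚ n) c (f n) ⟩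
    (ℕ→ℚ n - c) * f n             ∎
    where open ℚ-Solver.+-*-Solver

  -- θ is injective away from the constant term.
  θ≈κ⊛X⊛-unique : ∀ a {F G} → θ F ≈ κ a ⊛ (X ⊛ F) → θ G ≈ κ a ⊛ (X ⊛ G) → F 0 ≡ G 0 → F ≈ G
  θ≈κ⊛X⊛-unique a θF θG F0≡G0 zero = F0≡G0
  θ≈κ⊛X⊛-unique a {F} {G} θF θG F0≡G0 (suc n) = *-cancelˡ (ℕ→ℚ (suc n)) (ℕ→ℚ-≢0 (suc n)) (begin
    θ F (suc n)                 ≡⟨ θF (suc n) ⟩
    (κ a ⊛ (X ⊛ F)) (suc n)     ≡⟨ κ-⊛ a (X ⊛ F) (suc n) ⟩
    a * (X ⊛ F) (suc n)         ≡⟨ cong (a *_) (trans (X-⊛-suc F n) (trans Fn≡Gn (sym (X-⊛-suc G n)))) ⟩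
    a * (X ⊛ G) (suc n)         ≡⟨ κ-⊛ a (X ⊛ G) (suc n) ⟨
    (κ a ⊛ (X ⊛ G)) (suc n)     ≡⟨ θG (suc n) ⟨
    θ G (suc n)                 ∎)
    where
    Fn≡Gn : F n ≡ G n
    Fn≡Gn = θ≈κ⊛X⊛-unique a θF θG F0≡G0 n

  θ-expS : ∀ a → θ (expS a) ≈ κ a ⊛ (X ⊛ expS a)
  θ-expS a zero = begin
    0ℚ * expS a 0        ≡⟨ ℚP.*-zeroˡ (expS a 0) ⟩
    0ℚ                   ≡⟨ ℚP.*-zeroʳ a ⟨
    a * 0ℚ               ≡⟨ cong (a *_) (X-⊛-zero (expS a)) ⟨
    a * (X ⊛ expS a) 0   ≡⟨ κ-⊛ a (X ⊛ expS a) 0 ⟨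
    (κ a ⊛ (X ⊛ expS a)) 0 ∎
  θ-expS a (suc n) = begin
    s * (a * aⁿ * inv (ℕ→ℚ (suc n !)))          ≡⟨ cong (λ x → s * (a * aⁿ * x)) (trans (cong inv (ℕ→ℚ-* (suc n) (n !))) (inv-distrib-* s (ℕ→ℚ (n !)))) ⟩
    s * (a * aⁿ * (inv s * inv (ℕ→ℚ (n !))))    ≡⟨ solve 5 (λ s a p i j → s :* (a :* p :* (i :* j)) := (s :* i) :* (a :* (p :* j))) refl s a aⁿ (inv s) (inv (ℕ→ℚ (n !))) ⟩
    (s * inv s) * (a * expS a n)                ≡⟨ cong (_* (a * expS a n)) (inv-inverseʳ s (ℕ→ℚ-≢0 (suc n))) ⟩
    1ℚ * (a * expS a n)                         ≡⟨ ℚP.*-identityˡ _ ⟩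
    a * expS a n                                ≡⟨ cong (a *_) (X-⊛-suc (expS a) n) ⟨
    a * (X ⊛ expS a) (suc n)                    ≡⟨ κ-⊛ a (X ⊛ expS a) (suc n) ⟨
    (κ a ⊛ (X ⊛ expS a)) (suc n)                ∎
    where
    open ℚ-Solver.+-*-Solver
    s = ℕ→ℚ (suc n)
    aⁿ = a ^ℚ n

  expS-0 : expS 0ℚ ≈ κ 1ℚ
  expS-0 zero = refl
  expS-0 (suc n) = trans (cong (_* inv (ℕ→ℚ (suc n !))) (ℚP.*-zeroˡ (0ℚ ^ℚ n))) (ℚP.*-zeroˡ (inv (ℕ→ℚ (suc n !))))

module _ where
  open ≈-Reasoning
  open Series-Solver

  expS-+ : ∀ a b → expS a ⊛ expS b ≈ expS (a + b)
  expS-+ a b = θ≈κ⊛X⊛-unique (a + b) θ[eᵃeᵇ] (θ-expS (a + b)) refl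
    where
    θ[eᵃeᵇ] : θ (expS a ⊛ expS b) ≈ κ (a + b) ⊛ (X ⊛ (expS a ⊛ expS b))
    θ[eᵃeᵇ] = begin
      θ (expS a ⊛ expS b)
        ≈⟨ θ-⊛ (expS a) (expS b) ⟩
      (θ (expS a) ⊛ expS b) ⊕ (expS a ⊛ θ (expS b))
        ≈⟨ ⊕-cong (⊛-congˡ (expS b) (θ-expS a)) (⊛-congʳ (expS a) (θ-expS b)) ⟩
      ((κ a ⊛ (X ⊛ expS a)) ⊛ expS b) ⊕ (expS a ⊛ (κ b ⊛ (X ⊛ expS b)))
        ≈⟨ solve 5 (λ ka kb x ea eb → (ka :* (x :* ea)) :* eb :+ ea :* (kb :* (x :* eb)) := (ka :+ kb) :* (x :* (ea :* eb))) ≈-refl (κ a) (κ b) X (expS a) (expS b) ⟩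
      (κ a ⊕ κ b) ⊛ (X ⊛ (expS a ⊛ expS b))
        ≈⟨ ⊛-congˡ (X ⊛ (expS a ⊛ expS b)) (κ-+ a b) ⟨
      κ (a + b) ⊛ (X ⊛ (expS a ⊛ expS b))
        ∎

module _ where
  open ≡-Reasoning

  map-applyUpTo : ∀ (g : ℕ → ℚ) (f : ℕ → ℕ) n → map g (applyUpTo f n) ≡ applyUpTo (λ k → g (f k)) n
  map-applyUpTo g f zero = refl
  map-applyUpTo g f (suc n) = cong (g (f 0) ∷_) (map-applyUpTo g (λ k → f (suc k)) n)

  zipWith-applyUpTo : ∀ (u v : ℕ → ℚ) n →
                      zipWith _*_ (applyUpTo u n) (applyUpTo v n) ≡ applyUpTo (λ k → u k * v k) n
  zipWith-applyUpTo u v zero = refl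
  zipWith-applyUpTo u v (suc n) = cong (u 0 * v 0 ∷_) (zipWith-applyUpTo (λ k → u (suc k)) (λ k → v (suc k)) n)

  sumℚ-applyUpTo : ∀ (f : ℕ → ℚ) n → sumℚ (applyUpTo f (suc n)) ≡ Σ≤ n f
  sumℚ-applyUpTo f zero = ℚP.+-identityʳ (f 0)
  sumℚ-applyUpTo f (suc n) = trans (cong (_+_ (f 0)) (sumℚ-applyUpTo (λ k → f (suc k)) n)) (sym (Σ≤-suc n f))

  invCoeffs≡applyUpTo : ∀ n → invCoeffs n ≡ applyUpTo (λ k → w/expm1 (n ∸ k)) (suc n)
  invCoeffs≡applyUpTo zero = refl
  invCoeffs≡applyUpTo (suc n) = cong (w/expm1 (suc n) ∷_) (invCoeffs≡applyUpTo n)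

  w/expm1-suc : ∀ n → w/expm1 (suc n) ≡ - Σ≤ n (λ k → expm1/w (suc k) * w/expm1 (n ∸ k))
  w/expm1-suc n = cong -_ (begin
    sumℚ (zipWith _*_ (map (λ k → expm1/w (suc k)) (upTo (suc n))) (invCoeffs n))
      ≡⟨ cong₂ (λ us vs → sumℚ (zipWith _*_ us vs)) (map-applyUpTo (λ k → expm1/w (suc k)) (λ k → k) (suc n)) (invCoeffs≡applyUpTo n) ⟩
    sumℚ (zipWith _*_ (applyUpTo (λ k → expm1/w (suc k)) (suc n)) (applyUpTo (λ k → w/expm1 (n ∸ k)) (suc n)))
      ≡⟨ cong sumℚ (zipWith-applyUpTo (λ k → expm1/w (suc k)) (λ k → w/expm1 (n ∸ k)) (suc n)) ⟩
    sumℚ (applyUpTo (λ k → expm1/w (suc k) * w/expm1 (n ∸ k)) (suc n))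
      ≡⟨ sumℚ-applyUpTo _ n ⟩
    Σ≤ n (λ k → expm1/w (suc k) * w/expm1 (n ∸ k))
      ∎)

  expm1/w⊛w/expm1 : expm1/w ⊛ w/expm1 ≈ κ 1ℚ
  expm1/w⊛w/expm1 zero = refl
  expm1/w⊛w/expm1 (suc n) = begin
    Σ≤ (suc n) (λ k → expm1/w k * w/expm1 (suc n ∸ k))   ≡⟨ Σ≤-suc n _ ⟩
    1ℚ * w/expm1 (suc n) + S                             ≡⟨ cong (_+ S) (trans (ℚP.*-identityˡ _) (w/expm1-suc n)) ⟩
    - S + S                                              ≡⟨ ℚP.+-inverseˡ S ⟩
    0ℚ                                                   ∎
    where
    S : ℚ
    S = Σ≤ n (λ k → expm1/w (suc k) * w/expm1 (n ∸ k))

  expS-1-⊖-1 : expS 1ℚ ⊖ κ 1ℚ ≈ X ⊛ expm1/w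
  expS-1-⊖-1 zero = sym (X-⊛-zero expm1/w)
  expS-1-⊖-1 (suc n) = begin
    1ℚ * (1ℚ ^ℚ n) * inv (ℕ→ℚ (suc n !)) + - 0ℚ  ≡⟨ cong (λ x → x * inv (ℕ→ℚ (suc n !)) + - 0ℚ) (trans (ℚP.*-identityˡ _) (1^n n)) ⟩
    1ℚ * inv (ℕ→ℚ (suc n !)) + - 0ℚ              ≡⟨ trans (ℚP.+-identityʳ _) (ℚP.*-identityˡ _) ⟩
    expm1/w n                                    ≡⟨ X-⊛-suc expm1/w n ⟨
    (X ⊛ expm1/w) (suc n)                        ∎
    where
    1^n : ∀ n → 1ℚ ^ℚ n ≡ 1ℚ
    1^n zero = refl
    1^n (suc n) = trans (ℚP.*-identityˡ _) (1^n n)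

-- The series H = w e^{w/2}/(e^w − 1) = (w/2)/sinh(w/2)

¼ : ℚ
¼ = ½ * ½

H : Series
H = w/expm1 ⊛ expS ½

-- 2 sinh(w/2), cosh(w/2) and (w/2) coth(w/2)
twoSinh : Series
twoSinh = expS ½ ⊖ expS -½

cosh : Series
cosh = κ ½ ⊛ (expS ½ ⊕ expS -½)

halfCoth : Series
halfCoth = H ⊛ cosh

module _ where
  open ≈-Reasoning
  open Series-Solver

  expS½⊛expS-½ : expS ½ ⊛ expS -½ ≈ κ 1ℚ
  expS½⊛expS-½ = ≈-trans (expS-+ ½ -½) expS-0

  twoSinh≈ : twoSinh ≈ expS -½ ⊛ (X ⊛ expm1/w)
  twoSinh≈ = begin
    expS ½ ⊖ expS -½                    ≈⟨ ⊖-cong (expS-+ -½ 1ℚ) (≈-refl {expS -½}) ⟨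
    (expS -½ ⊛ expS 1ℚ) ⊖ expS -½       ≈⟨ solve 2 (λ a b → a :* b :- a := a :* (b :- con 1ℚ)) ≈-refl (expS -½) (expS 1ℚ) ⟩
    expS -½ ⊛ (expS 1ℚ ⊖ κ 1ℚ)          ≈⟨ ⊛-congʳ (expS -½) expS-1-⊖-1 ⟩
    expS -½ ⊛ (X ⊛ expm1/w)             ∎

  H⊛twoSinh : H ⊛ twoSinh ≈ X
  H⊛twoSinh = begin
    (w/expm1 ⊛ expS ½) ⊛ twoSinh
      ≈⟨ ⊛-congʳ (w/expm1 ⊛ expS ½) twoSinh≈ ⟩
    (w/expm1 ⊛ expS ½) ⊛ (expS -½ ⊛ (X ⊛ expm1/w))
      ≈⟨ solve 5 (λ b e f x g → (b :* e) :* (f :* (x :* g)) := (g :* b) :* ((e :* f) :* x)) ≈-refl w/expm1 (expS ½) (expS -½) X expm1/w ⟩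
    (expm1/w ⊛ w/expm1) ⊛ ((expS ½ ⊛ expS -½) ⊛ X)
      ≈⟨ ⊛-cong expm1/w⊛w/expm1 (⊛-congˡ X expS½⊛expS-½) ⟩
    κ 1ℚ ⊛ (κ 1ℚ ⊛ X)
      ≈⟨ solve 1 (λ x → con 1ℚ :* (con 1ℚ :* x) := x) ≈-refl X ⟩
    X ∎

  θ-twoSinh : θ twoSinh ≈ X ⊛ cosh
  θ-twoSinh = begin
    θ (expS ½ ⊖ expS -½)                                     ≈⟨ θ-⊖ (expS ½) (expS -½) ⟩
    θ (expS ½) ⊖ θ (expS -½)                                 ≈⟨ ⊖-cong (θ-expS ½) (θ-expS -½) ⟩
    (κ ½ ⊛ (X ⊛ expS ½)) ⊖ (κ -½ ⊛ (X ⊛ expS -½))            ≈⟨ solve 3 (λ x a b → con ½ :* (x :* a) :- con -½ :* (x :* b) := x :* (con ½ :* (a :+ b))) ≈-refl X (expS ½) (expS -½) ⟩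
    X ⊛ cosh                                                 ∎

  θ-cosh : θ cosh ≈ κ ¼ ⊛ (X ⊛ twoSinh)
  θ-cosh = begin
    θ (κ ½ ⊛ (expS ½ ⊕ expS -½))
      ≈⟨ θ-κ-⊛ ½ (expS ½ ⊕ expS -½) ⟩
    κ ½ ⊛ θ (expS ½ ⊕ expS -½)
      ≈⟨ ⊛-congʳ (κ ½) (≈-trans (θ-⊕ (expS ½) (expS -½)) (⊕-cong (θ-expS ½) (θ-expS -½))) ⟩
    κ ½ ⊛ ((κ ½ ⊛ (X ⊛ expS ½)) ⊕ (κ -½ ⊛ (X ⊛ expS -½)))
      ≈⟨ solve 3 (λ x a b → con ½ :* (con ½ :* (x :* a) :+ con -½ :* (x :* b)) := con ¼ :* (x :* (a :- b))) ≈-refl X (expS ½) (expS -½) ⟩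
    κ ¼ ⊛ (X ⊛ twoSinh)
      ∎

  cosh²-¼twoSinh² : cosh ⊛ cosh ⊖ κ ¼ ⊛ (twoSinh ⊛ twoSinh) ≈ κ 1ℚ
  cosh²-¼twoSinh² = begin
    cosh ⊛ cosh ⊖ κ ¼ ⊛ (twoSinh ⊛ twoSinh)
      ≈⟨ solve 2 (λ a b → (con ½ :* (a :+ b)) :* (con ½ :* (a :+ b)) :- con ¼ :* ((a :- b) :* (a :- b)) := a :* b) ≈-refl (expS ½) (expS -½) ⟩
    expS ½ ⊛ expS -½
      ≈⟨ expS½⊛expS-½ ⟩
    κ 1ℚ
      ∎

  θH⊛twoSinh : θ H ⊛ twoSinh ≈ X ⊖ H ⊛ (X ⊛ cosh)
  θH⊛twoSinh = begin
    θ H ⊛ twoSinh                                           ≈⟨ solve 2 (λ a b → a := (a :+ b) :- b) ≈-refl (θ H ⊛ twoSinh) (H ⊛ (X ⊛ cosh)) ⟩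
    (θ H ⊛ twoSinh ⊕ H ⊛ (X ⊛ cosh)) ⊖ H ⊛ (X ⊛ cosh)       ≈⟨ ⊖-cong leibniz (≈-refl {H ⊛ (X ⊛ cosh)}) ⟩
    X ⊖ H ⊛ (X ⊛ cosh)                                      ∎
    where
    leibniz : θ H ⊛ twoSinh ⊕ H ⊛ (X ⊛ cosh) ≈ X
    leibniz = begin
      θ H ⊛ twoSinh ⊕ H ⊛ (X ⊛ cosh)     ≈⟨ ⊕-cong (≈-refl {θ H ⊛ twoSinh}) (⊛-congʳ H θ-twoSinh) ⟨
      θ H ⊛ twoSinh ⊕ H ⊛ θ twoSinh      ≈⟨ θ-⊛ H twoSinh ⟨
      θ (H ⊛ twoSinh)                    ≈⟨ θ-cong H⊛twoSinh ⟩
      θ X                                ≈⟨ θ-X ⟩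
      X                                  ∎

  θ-H : θ H ≈ H ⊖ H ⊛ halfCoth
  θ-H = X-⊛-cancel (begin
    X ⊛ θ H                              ≈⟨ ⊛-congˡ (θ H) H⊛twoSinh ⟨
    (H ⊛ twoSinh) ⊛ θ H                  ≈⟨ solve 3 (λ a b c → (a :* b) :* c := a :* (c :* b)) ≈-refl H twoSinh (θ H) ⟩
    H ⊛ (θ H ⊛ twoSinh)                  ≈⟨ ⊛-congʳ H θH⊛twoSinh ⟩
    H ⊛ (X ⊖ H ⊛ (X ⊛ cosh))             ≈⟨ solve 3 (λ h x c → h :* (x :- h :* (x :* c)) := x :* (h :- h :* (h :* c))) ≈-refl H X cosh ⟩
    X ⊛ (H ⊖ H ⊛ halfCoth)               ∎)

  θ-halfCoth : θ halfCoth ≈ halfCoth ⊖ halfCoth ⊛ halfCoth ⊕ κ ¼ ⊛ (X ⊛ X)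
  θ-halfCoth = begin
    θ (H ⊛ cosh)
      ≈⟨ θ-⊛ H cosh ⟩
    θ H ⊛ cosh ⊕ H ⊛ θ cosh
      ≈⟨ ⊕-cong (⊛-congˡ cosh θ-H) (⊛-congʳ H θ-cosh) ⟩
    (H ⊖ H ⊛ halfCoth) ⊛ cosh ⊕ H ⊛ (κ ¼ ⊛ (X ⊛ twoSinh))
      ≈⟨ solve 4 (λ h c x s → (h :- h :* (h :* c)) :* c :+ h :* (con ¼ :* (x :* s)) := (h :* c :- (h :* c) :* (h :* c)) :+ con ¼ :* (x :* (h :* s))) ≈-refl H cosh X twoSinh ⟩
    halfCoth ⊖ halfCoth ⊛ halfCoth ⊕ κ ¼ ⊛ (X ⊛ (H ⊛ twoSinh))
      ≈⟨ ⊕-cong (≈-refl {halfCoth ⊖ halfCoth ⊛ halfCoth}) (⊛-congʳ (κ ¼) (⊛-congʳ X H⊛twoSinh)) ⟩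
    halfCoth ⊖ halfCoth ⊛ halfCoth ⊕ κ ¼ ⊛ (X ⊛ X)
      ∎

  halfCoth²-¼X² : halfCoth ⊛ halfCoth ⊖ κ ¼ ⊛ (X ⊛ X) ≈ H ⊛ H
  halfCoth²-¼X² = begin
    halfCoth ⊛ halfCoth ⊖ κ ¼ ⊛ (X ⊛ X)
      ≈⟨ ⊖-cong (≈-refl {halfCoth ⊛ halfCoth}) (⊛-congʳ (κ ¼) (⊛-cong H⊛twoSinh H⊛twoSinh)) ⟨
    halfCoth ⊛ halfCoth ⊖ κ ¼ ⊛ ((H ⊛ twoSinh) ⊛ (H ⊛ twoSinh))
      ≈⟨ solve 3 (λ h c s → (h :* c) :* (h :* c) :- con ¼ :* ((h :* s) :* (h :* s)) := (h :* h) :* ((c :* c) :- con ¼ :* (s :* s))) ≈-refl H cosh twoSinh ⟩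
    (H ⊛ H) ⊛ (cosh ⊛ cosh ⊖ κ ¼ ⊛ (twoSinh ⊛ twoSinh))
      ≈⟨ ⊛-congʳ (H ⊛ H) cosh²-¼twoSinh² ⟩
    (H ⊛ H) ⊛ κ 1ℚ
      ≈⟨ solve 1 (λ a → a :* con 1ℚ := a) ≈-refl (H ⊛ H) ⟩
    H ⊛ H
      ∎

module _ where
  open ≈-Reasoning
  open Series-Solver

  ^S-zero : ∀ f → f ^S 0 ≈ κ 1ℚ
  ^S-zero f zero = refl
  ^S-zero f (suc n) = refl

  κ-ℕ→ℚ-suc : ∀ l → κ (ℕ→ℚ (suc l)) ≈ κ 1ℚ ⊕ κ (ℕ→ℚ l)
  κ-ℕ→ℚ-suc l = ≈-trans (κ-cong (ℕ→ℚ-suc l)) (κ-+ 1ℚ (ℕ→ℚ l))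

  θ∸-cong : ∀ c {f g} → f ≈ g → θ∸ c f ≈ θ∸ c g
  θ∸-cong c f≈g = ⊖-cong (θ-cong f≈g) (⊛-congʳ (κ c) f≈g)

  w/expm1^l⊛expS≈H^l : ∀ l → (w/expm1 ^S l) ⊛ expS (ℕ→ℚ l * ½) ≈ H ^S l
  w/expm1^l⊛expS≈H^l zero = begin
    (w/expm1 ^S 0) ⊛ expS 0ℚ     ≈⟨ ⊛-cong (^S-zero w/expm1) expS-0 ⟩
    κ 1ℚ ⊛ κ 1ℚ                   ≈⟨ κ-⊛-identityˡ (κ 1ℚ) ⟩
    κ 1ℚ                          ≈⟨ ^S-zero H ⟨
    H ^S 0                        ∎
  w/expm1^l⊛expS≈H^l (suc l) = begin
    (w/expm1 ⊛ (w/expm1 ^S l)) ⊛ expS (ℕ→ℚ (suc l) * ½)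
      ≈⟨ ⊛-congʳ (w/expm1 ⊛ (w/expm1 ^S l)) (≈-trans (expS-+ ½ (ℕ→ℚ l * ½)) (expS-cong half-suc)) ⟨
    (w/expm1 ⊛ (w/expm1 ^S l)) ⊛ (expS ½ ⊛ expS (ℕ→ℚ l * ½))
      ≈⟨ solve 4 (λ b bˡ e eˡ → (b :* bˡ) :* (e :* eˡ) := (b :* e) :* (bˡ :* eˡ)) ≈-refl w/expm1 (w/expm1 ^S l) (expS ½) (expS (ℕ→ℚ l * ½)) ⟩
    H ⊛ ((w/expm1 ^S l) ⊛ expS (ℕ→ℚ l * ½))
      ≈⟨ ⊛-congʳ H (w/expm1^l⊛expS≈H^l l) ⟩
    H ⊛ (H ^S l)
      ∎
    where
    expS-cong : ∀ {a b} → a ≡ b → expS a ≈ expS b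
    expS-cong refl = ≈-refl
    half-suc : ½ + ℕ→ℚ l * ½ ≡ ℕ→ℚ (suc l) * ½
    half-suc = trans (sym (ℚP.*-distribʳ-+ ½ 1ℚ (ℕ→ℚ l))) (cong (_* ½) (sym (ℕ→ℚ-suc l)))

  θ-H^ : ∀ l → θ (H ^S l) ≈ κ (ℕ→ℚ l) ⊛ (H ^S l ⊖ (H ^S l) ⊛ halfCoth)
  θ-H^ zero = begin
    θ (H ^S 0)                                   ≈⟨ ≈-trans (θ-cong (^S-zero H)) (θ-κ 1ℚ) ⟩
    𝟘                                            ≈⟨ (λ n → sym (trans (κ-⊛ 0ℚ g n) (ℚP.*-zeroˡ (g n)))) ⟩
    κ 0ℚ ⊛ g                                     ∎
    where
    g = H ^S 0 ⊖ (H ^S 0) ⊛ halfCoth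
  θ-H^ (suc l) = begin
    θ (H ⊛ f)
      ≈⟨ θ-⊛ H f ⟩
    θ H ⊛ f ⊕ H ⊛ θ f
      ≈⟨ ⊕-cong (⊛-congˡ f θ-H) (⊛-congʳ H (θ-H^ l)) ⟩
    (H ⊖ H ⊛ halfCoth) ⊛ f ⊕ H ⊛ (L ⊛ (f ⊖ f ⊛ halfCoth))
      ≈⟨ solve 4 (λ h p f l → (h :- h :* p) :* f :+ h :* (l :* (f :- f :* p)) := (con 1ℚ :+ l) :* (h :* f :- (h :* f) :* p)) ≈-refl H halfCoth f L ⟩
    (κ 1ℚ ⊕ L) ⊛ (H ⊛ f ⊖ (H ⊛ f) ⊛ halfCoth)
      ≈⟨ ⊛-congˡ (H ⊛ f ⊖ (H ⊛ f) ⊛ halfCoth) (κ-ℕ→ℚ-suc l) ⟨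
    κ (ℕ→ℚ (suc l)) ⊛ (H ⊛ f ⊖ (H ⊛ f) ⊛ halfCoth)
      ∎
    where
    f = H ^S l
    L = κ (ℕ→ℚ l)

  θ∸θ∸-H^ : ∀ l → θ∸ (ℕ→ℚ (suc l)) (θ∸ (ℕ→ℚ l) (H ^S l)) ≈
                   κ (ℕ→ℚ l) ⊛ ((κ 1ℚ ⊕ κ (ℕ→ℚ l)) ⊛ ((H ^S l) ⊛ (halfCoth ⊛ halfCoth)))
                   ⊖ κ ¼ ⊛ (κ (ℕ→ℚ l) ⊛ (X ⊛ (X ⊛ (H ^S l))))
  θ∸θ∸-H^ l = begin
    θ∸ (ℕ→ℚ (suc l)) (θ∸ (ℕ→ℚ l) f)
      ≈⟨ θ∸-cong (ℕ→ℚ (suc l)) θ∸-H^ ⟩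
    θ (⊝ (L ⊛ (f ⊛ P))) ⊖ κ (ℕ→ℚ (suc l)) ⊛ (⊝ (L ⊛ (f ⊛ P)))
      ≈⟨ ⊖-cong θ[L⊛f⊛P] (⊛-congˡ (⊝ (L ⊛ (f ⊛ P))) (κ-ℕ→ℚ-suc l)) ⟩
    ⊝ (L ⊛ (θ f ⊛ P ⊕ f ⊛ θ P)) ⊖ (κ 1ℚ ⊕ L) ⊛ (⊝ (L ⊛ (f ⊛ P)))
      ≈⟨ ⊖-cong (⊝-cong (⊛-congʳ L (⊕-cong (⊛-congˡ P (θ-H^ l)) (⊛-congʳ f θ-halfCoth)))) (≈-refl {(κ 1ℚ ⊕ L) ⊛ (⊝ (L ⊛ (f ⊛ P)))}) ⟩
    ⊝ (L ⊛ ((L ⊛ (f ⊖ f ⊛ P)) ⊛ P ⊕ f ⊛ (P ⊖ P ⊛ P ⊕ κ ¼ ⊛ (X ⊛ X)))) ⊖ (κ 1ℚ ⊕ L) ⊛ (⊝ (L ⊛ (f ⊛ P)))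
      ≈⟨ solve 4 (λ l f p x → :- (l :* ((l :* (f :- f :* p)) :* p :+ f :* (p :- p :* p :+ con ¼ :* (x :* x)))) :- (con 1ℚ :+ l) :* (:- (l :* (f :* p)))
                              := l :* ((con 1ℚ :+ l) :* (f :* (p :* p))) :- con ¼ :* (l :* (x :* (x :* f)))) ≈-refl L f P X ⟩
    L ⊛ ((κ 1ℚ ⊕ L) ⊛ (f ⊛ (P ⊛ P))) ⊖ κ ¼ ⊛ (L ⊛ (X ⊛ (X ⊛ f)))
      ∎
    where
    f = H ^S l
    L = κ (ℕ→ℚ l)
    P = halfCoth

    θ∸-H^ : θ∸ (ℕ→ℚ l) f ≈ ⊝ (L ⊛ (f ⊛ P))
    θ∸-H^ = begin
      θ f ⊖ L ⊛ f                    ≈⟨ ⊖-cong (θ-H^ l) (≈-refl {L ⊛ f}) ⟩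
      L ⊛ (f ⊖ f ⊛ P) ⊖ L ⊛ f        ≈⟨ solve 3 (λ l f p → l :* (f :- f :* p) :- l :* f := :- (l :* (f :* p))) ≈-refl L f P ⟩
      ⊝ (L ⊛ (f ⊛ P))                ∎

    θ[L⊛f⊛P] : θ (⊝ (L ⊛ (f ⊛ P))) ≈ ⊝ (L ⊛ (θ f ⊛ P ⊕ f ⊛ θ P))
    θ[L⊛f⊛P] = ≈-trans (θ-⊝ (L ⊛ (f ⊛ P))) (⊝-cong (≈-trans (θ-κ-⊛ (ℕ→ℚ l) (f ⊛ P)) (⊛-congʳ L (θ-⊛ f P))))

  H^-recurrence : ∀ l → κ (ℕ→ℚ l) ⊛ (κ (ℕ→ℚ (suc l)) ⊛ (H ^S (2 ℕ.+ l))) ≈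
                        θ∸ (ℕ→ℚ (suc l)) (θ∸ (ℕ→ℚ l) (H ^S l)) ⊖ κ ¼ ⊛ (κ (ℕ→ℚ l) ⊛ (κ (ℕ→ℚ l) ⊛ (X ⊛ (X ⊛ (H ^S l)))))
  H^-recurrence l = begin
    L ⊛ (κ (ℕ→ℚ (suc l)) ⊛ (H ⊛ (H ⊛ f)))
      ≈⟨ ⊛-congʳ L (⊛-cong (κ-ℕ→ℚ-suc l) (≈-trans (solve 2 (λ h f → h :* (h :* f) := (h :* h) :* f) ≈-refl H f) (⊛-congˡ f (≈-sym halfCoth²-¼X²)))) ⟩
    L ⊛ ((κ 1ℚ ⊕ L) ⊛ ((P ⊛ P ⊖ κ ¼ ⊛ (X ⊛ X)) ⊛ f))
      ≈⟨ solve 4 (λ l f p x → l :* ((con 1ℚ :+ l) :* ((p :* p :- con ¼ :* (x :* x)) :* f))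
                             := (l :* ((con 1ℚ :+ l) :* (f :* (p :* p))) :- con ¼ :* (l :* (x :* (x :* f)))) :- con ¼ :* (l :* (l :* (x :* (x :* f))))) ≈-refl L f P X ⟩
    (L ⊛ ((κ 1ℚ ⊕ L) ⊛ (f ⊛ (P ⊛ P))) ⊖ κ ¼ ⊛ (L ⊛ (X ⊛ (X ⊛ f)))) ⊖ κ ¼ ⊛ (L ⊛ (L ⊛ (X ⊛ (X ⊛ f))))
      ≈⟨ ⊖-cong (θ∸θ∸-H^ l) (≈-refl {κ ¼ ⊛ (L ⊛ (L ⊛ (X ⊛ (X ⊛ f))))}) ⟨
    θ∸ (ℕ→ℚ (suc l)) (θ∸ (ℕ→ℚ l) f) ⊖ κ ¼ ⊛ (L ⊛ (L ⊛ (X ⊛ (X ⊛ f))))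
      ∎
    where
    f = H ^S l
    L = κ (ℕ→ℚ l)
    P = halfCoth

module _ where
  open ≡-Reasoning

  H^-coeff-recurrence :
    ∀ l n → ℕ→ℚ l * (ℕ→ℚ (suc l) * (H ^S (2 ℕ.+ l)) (2 ℕ.+ n)) ≡
            (ℕ→ℚ (2 ℕ.+ n) - ℕ→ℚ (suc l)) * ((ℕ→ℚ (2 ℕ.+ n) - ℕ→ℚ l) * (H ^S l) (2 ℕ.+ n))
            - ¼ * (ℕ→ℚ l * (ℕ→ℚ l * (H ^S l) n))
  H^-coeff-recurrence l n = begin
    a * (b * (H ^S (2 ℕ.+ l)) N)
      ≡⟨ trans (κ-⊛ a (κ b ⊛ (H ^S (2 ℕ.+ l))) N) (cong (a *_) (κ-⊛ b (H ^S (2 ℕ.+ l)) N)) ⟨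
    (κ a ⊛ (κ b ⊛ (H ^S (2 ℕ.+ l)))) N
      ≡⟨ H^-recurrence l N ⟩
    θ∸ b (θ∸ a f) N - (κ ¼ ⊛ (κ a ⊛ (κ a ⊛ (X ⊛ (X ⊛ f))))) N
      ≡⟨ cong₂ _-_ (trans (θ∸-coeff b (θ∸ a f) N) (cong ((ℕ→ℚ N - b) *_) (θ∸-coeff a f N))) w²-coeff ⟩
    (ℕ→ℚ N - b) * ((ℕ→ℚ N - a) * f N) - ¼ * (a * (a * f n))
      ∎
    where
    a = ℕ→ℚ l
    b = ℕ→ℚ (suc l)
    f = H ^S l
    N = 2 ℕ.+ n
    w²-coeff : (κ ¼ ⊛ (κ a ⊛ (κ a ⊛ (X ⊛ (X ⊛ f))))) N ≡ ¼ * (a * (a * f n))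
    w²-coeff = begin
      (κ ¼ ⊛ (κ a ⊛ (κ a ⊛ (X ⊛ (X ⊛ f))))) N    ≡⟨ κ-⊛ ¼ (κ a ⊛ (κ a ⊛ (X ⊛ (X ⊛ f)))) N ⟩
      ¼ * (κ a ⊛ (κ a ⊛ (X ⊛ (X ⊛ f)))) N        ≡⟨ cong (¼ *_) (κ-⊛ a (κ a ⊛ (X ⊛ (X ⊛ f))) N) ⟩
      ¼ * (a * (κ a ⊛ (X ⊛ (X ⊛ f))) N)          ≡⟨ cong (λ x → ¼ * (a * x)) (κ-⊛ a (X ⊛ (X ⊛ f)) N) ⟩
      ¼ * (a * (a * (X ⊛ (X ⊛ f)) N))            ≡⟨ cong (λ x → ¼ * (a * (a * x))) (trans (X-⊛-suc (X ⊛ f) (suc n)) (X-⊛-suc f n)) ⟩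
      ¼ * (a * (a * f n))                        ∎

  -- The condition makes one factor of the first term of H^-coeff-recurrence vanish; then the factor l + 1 cancels.
  H^-coeff-step : ∀ l n → 2 ℕ.+ n ≡ suc l ⊎ 2 ℕ.+ n ≡ 2 ℕ.+ l →
                  ℕ→ℚ (2 ℕ.+ l) * (H ^S (3 ℕ.+ l)) (2 ℕ.+ n) ≡ - (¼ * (ℕ→ℚ (suc l) * (H ^S (suc l)) n))
  H^-coeff-step l n cond = *-cancelˡ a (ℕ→ℚ-≢0 (suc l)) (begin
    a * (ℕ→ℚ (2 ℕ.+ l) * (H ^S (3 ℕ.+ l)) N)        ≡⟨ H^-coeff-recurrence (suc l) n ⟩
    vanishing - ¼ * (a * (a * f n))                ≡⟨ cong (_- ¼ * (a * (a * f n))) (vanishes cond) ⟩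
    0ℚ - ¼ * (a * (a * f n))                       ≡⟨ solve 2 (λ a x → con 0ℚ :- con ¼ :* (a :* (a :* x)) := a :* (:- (con ¼ :* (a :* x)))) refl a (f n) ⟩
    a * - (¼ * (a * f n))                          ∎)
    where
    open ℚ-Solver.+-*-Solver
    a = ℕ→ℚ (suc l)
    f = H ^S (suc l)
    N = 2 ℕ.+ n
    vanishing : ℚ
    vanishing = (ℕ→ℚ N - ℕ→ℚ (2 ℕ.+ l)) * ((ℕ→ℚ N - a) * f N)

    p≡q⇒p-q≡0 : ∀ {p q} → p ≡ q → p - q ≡ 0ℚ
    p≡q⇒p-q≡0 {p} refl = ℚP.+-inverseʳ p

    vanishes : N ≡ suc l ⊎ N ≡ 2 ℕ.+ l → vanishing ≡ 0ℚ
    vanishes (inj₁ N≡1+l) = begin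
      (ℕ→ℚ N - ℕ→ℚ (2 ℕ.+ l)) * ((ℕ→ℚ N - a) * f N)  ≡⟨ cong (λ x → (ℕ→ℚ N - ℕ→ℚ (2 ℕ.+ l)) * (x * f N)) (p≡q⇒p-q≡0 (cong ℕ→ℚ N≡1+l)) ⟩
      (ℕ→ℚ N - ℕ→ℚ (2 ℕ.+ l)) * (0ℚ * f N)             ≡⟨ cong ((ℕ→ℚ N - ℕ→ℚ (2 ℕ.+ l)) *_) (ℚP.*-zeroˡ (f N)) ⟩
      (ℕ→ℚ N - ℕ→ℚ (2 ℕ.+ l)) * 0ℚ                    ≡⟨ ℚP.*-zeroʳ (ℕ→ℚ N - ℕ→ℚ (2 ℕ.+ l)) ⟩
      0ℚ                                              ∎
    vanishes (inj₂ N≡2+l) = trans (cong (_* ((ℕ→ℚ N - a) * f N)) (p≡q⇒p-q≡0 (cong ℕ→ℚ N≡2+l))) (ℚP.*-zeroˡ ((ℕ→ℚ N - a) * f N))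

-- Both sides satisfy 4(l + 1) c(l + 2) = l c(l), written for l = j + 1.

record Recurrent (c : ℕ → Qπ) : Set where
  field
    coeff-step : ∀ j → (ℕ→ℚ 4 * ℕ→ℚ (2 ℕ.+ j)) * coeff (c (3 ℕ.+ j)) ≡ ℕ→ℚ (suc j) * coeff (c (suc j))
    piExp-step : ∀ j → piExp (c (3 ℕ.+ j)) ≡ piExp (c (suc j))

Recurrent-unique : ∀ {c d} → Recurrent c → Recurrent d → c 1 ≡ d 1 → c 2 ≡ d 2 → ∀ j → c (suc j) ≡ d (suc j)
Recurrent-unique rc rd c1≡d1 c2≡d2 zero = c1≡d1
Recurrent-unique rc rd c1≡d1 c2≡d2 (suc zero) = c2≡d2
Recurrent-unique {c} {d} rc rd c1≡d1 c2≡d2 (suc (suc j)) = cong₂ _·π^_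
  (*-cancelˡ (ℕ→ℚ 4 * ℕ→ℚ (2 ℕ.+ j)) 4[2+j]≢0 (begin
    (ℕ→ℚ 4 * ℕ→ℚ (2 ℕ.+ j)) * coeff (c (3 ℕ.+ j))   ≡⟨ Recurrent.coeff-step rc j ⟩
    ℕ→ℚ (suc j) * coeff (c (suc j))                 ≡⟨ cong (λ x → ℕ→ℚ (suc j) * coeff x) IH ⟩
    ℕ→ℚ (suc j) * coeff (d (suc j))                 ≡⟨ Recurrent.coeff-step rd j ⟨
    (ℕ→ℚ 4 * ℕ→ℚ (2 ℕ.+ j)) * coeff (d (3 ℕ.+ j))   ∎))
  (trans (Recurrent.piExp-step rc j) (trans (cong piExp IH) (sym (Recurrent.piExp-step rd j))))
  where
  open ≡-Reasoning
  IH : c (suc j) ≡ d (suc j)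
  IH = Recurrent-unique rc rd c1≡d1 c2≡d2 j
  4[2+j]≢0 : ℕ→ℚ 4 * ℕ→ℚ (2 ℕ.+ j) ≢ 0ℚ
  4[2+j]≢0 eq = ℕ→ℚ-≢0 (4 ℕ.* (2 ℕ.+ j)) (trans (ℕ→ℚ-* 4 (2 ℕ.+ j)) eq)

module _ where
  open ≡-Reasoning

  -- Γ((l + 3)/2)² = ((l + 1)/2)² Γ((l + 1)/2)² drives the recurrence for 𝒞.
  𝒞-recurrent : Recurrent 𝒞
  𝒞-recurrent = record { coeff-step = coeff-step ; piExp-step = λ j → refl }
    where
    coeff-step : ∀ j → (ℕ→ℚ 4 * ℕ→ℚ (2 ℕ.+ j)) * coeff (𝒞 (3 ℕ.+ j)) ≡ ℕ→ℚ (suc j) * coeff (𝒞 (suc j))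
    coeff-step j = begin
      (ℕ→ℚ 4 * u) * ((ℕ→ℚ 2 * inv (ℕ→ℚ 4 * (ℕ→ℚ 4 * 4ʲ⁺¹))) * (ℕ→ℚ ((2 ℕ.+ j) !) * inv (((u * ½) ^ℚ 2) * γ)))
        ≡⟨ cong₂ (λ x y → (ℕ→ℚ 4 * u) * ((ℕ→ℚ 2 * x) * y)) inv-4ʲ⁺³ (cong₂ _*_ [2+j]! inv-Γ²) ⟩
      (ℕ→ℚ 4 * u) * ((ℕ→ℚ 2 * (inv (ℕ→ℚ 4) * (inv (ℕ→ℚ 4) * inv 4ʲ⁺¹))) * ((u * (v * J)) * ((inv u * inv ½) * (inv u * inv ½) * inv γ)))
        ≡⟨ solve 6 (λ u iu v J I x → (con (ℕ→ℚ 4) :* u) :* ((con (ℕ→ℚ 2) :* (con (inv (ℕ→ℚ 4)) :* (con (inv (ℕ→ℚ 4)) :* I))) :* ((u :* (v :* J)) :* ((iu :* con (inv ½)) :* (iu :* con (inv ½)) :* x)))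
                                   := (u :* iu) :* ((u :* iu) :* (v :* ((con (ℕ→ℚ 2) :* I) :* (J :* x))))) refl u (inv u) v J (inv 4ʲ⁺¹) (inv γ) ⟩
      (u * inv u) * ((u * inv u) * (v * ((ℕ→ℚ 2 * inv 4ʲ⁺¹) * (J * inv γ))))
        ≡⟨ cong (λ x → x * (x * (v * ((ℕ→ℚ 2 * inv 4ʲ⁺¹) * (J * inv γ))))) (inv-inverseʳ u (ℕ→ℚ-≢0 (2 ℕ.+ j))) ⟩
      1ℚ * (1ℚ * (v * ((ℕ→ℚ 2 * inv 4ʲ⁺¹) * (J * inv γ))))
        ≡⟨ trans (ℚP.*-identityˡ _) (ℚP.*-identityˡ (v * ((ℕ→ℚ 2 * inv 4ʲ⁺¹) * (J * inv γ)))) ⟩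
      v * ((ℕ→ℚ 2 * inv 4ʲ⁺¹) * (J * inv γ))
        ∎
      where
      open ℚ-Solver.+-*-Solver
      u = ℕ→ℚ (2 ℕ.+ j)
      v = ℕ→ℚ (suc j)
      J = ℕ→ℚ (j !)
      4ʲ⁺¹ = ℕ→ℚ 4 ^ℚ suc j
      γ = coeff (Γ²-half (2 ℕ.+ j))

      inv-4ʲ⁺³ : inv (ℕ→ℚ 4 * (ℕ→ℚ 4 * 4ʲ⁺¹)) ≡ inv (ℕ→ℚ 4) * (inv (ℕ→ℚ 4) * inv 4ʲ⁺¹)
      inv-4ʲ⁺³ = trans (inv-distrib-* (ℕ→ℚ 4) (ℕ→ℚ 4 * 4ʲ⁺¹)) (cong (inv (ℕ→ℚ 4) *_) (inv-distrib-* (ℕ→ℚ 4) 4ʲ⁺¹))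

      [2+j]! : ℕ→ℚ ((2 ℕ.+ j) !) ≡ u * (v * J)
      [2+j]! = trans (ℕ→ℚ-* (2 ℕ.+ j) (suc j !)) (cong (u *_) (ℕ→ℚ-* (suc j) (j !)))

      inv-Γ² : inv (((u * ½) ^ℚ 2) * γ) ≡ (inv u * inv ½) * (inv u * inv ½) * inv γ
      inv-Γ² = begin
        inv (((u * ½) * ((u * ½) * 1ℚ)) * γ)                  ≡⟨ inv-distrib-* ((u * ½) * ((u * ½) * 1ℚ)) γ ⟩
        inv ((u * ½) * ((u * ½) * 1ℚ)) * inv γ                ≡⟨ cong (_* inv γ) (trans (inv-distrib-* (u * ½) ((u * ½) * 1ℚ)) (cong (inv (u * ½) *_) (inv-distrib-* (u * ½) 1ℚ))) ⟩
        inv (u * ½) * (inv (u * ½) * inv 1ℚ) * inv γ          ≡⟨ cong (λ x → x * (x * inv 1ℚ) * inv γ) (inv-distrib-* u ½) ⟩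
        (inv u * inv ½) * ((inv u * inv ½) * 1ℚ) * inv γ      ≡⟨ cong (λ x → x * inv γ) (cong ((inv u * inv ½) *_) (ℚP.*-identityʳ (inv u * inv ½))) ⟩
        (inv u * inv ½) * (inv u * inv ½) * inv γ             ∎

oddCoeff : ℕ → ℚ
oddCoeff l = sgn ((l ∸ 1) / 2) * (½ * (H ^S l) (l ∸ 1))

evenCoeff : ℕ → ℚ
evenCoeff l = sgn (suc (l / 2)) * (½ * (H ^S l) (l ∸ 2))

parity : ∀ l → l % 2 ≡ 0 ⊎ l % 2 ≡ 1
parity zero = inj₁ refl
parity (suc zero) = inj₂ refl
parity (suc (suc l)) = parity l

module _ where
  open ≡-Reasoning
  open ℚ-Solver.+-*-Solver

  bernoulliPoly-÷-! : ∀ l n → bernoulliPoly l n (ℕ→ℚ l * ½) * inv (ℕ→ℚ (n !)) ≡ (H ^S l) n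
  bernoulliPoly-÷-! l n = begin
    (n! * ((w/expm1 ^S l) ⊛ expS (ℕ→ℚ l * ½)) n) * inv n!   ≡⟨ cong (λ x → (n! * x) * inv n!) (w/expm1^l⊛expS≈H^l l n) ⟩
    (n! * (H ^S l) n) * inv n!                               ≡⟨ solve 3 (λ a h i → (a :* h) :* i := (a :* i) :* h) refl n! ((H ^S l) n) (inv n!) ⟩
    (n! * inv n!) * (H ^S l) n                               ≡⟨ cong (_* (H ^S l) n) (inv-inverseʳ n! (ℕ→ℚ-≢0 (n !) {{n ℕP.!≢0}})) ⟩
    1ℚ * (H ^S l) n                                          ≡⟨ ℚP.*-identityˡ ((H ^S l) n) ⟩
    (H ^S l) n                                               ∎
    where
    n! = ℕ→ℚ (n !)

  𝒞*-odd : ∀ l → l % 2 ≡ 1 → 𝒞* l ≡ oddCoeff l ·π^ (+ 0)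
  𝒞*-odd l l-odd rewrite l-odd = cong (λ x → (sgn ((l ∸ 1) / 2) * x) ·π^ (+ 0)) (begin
    B * inv (ℕ→ℚ 2 * ℕ→ℚ (n !))   ≡⟨ cong (B *_) (inv-distrib-* (ℕ→ℚ 2) (ℕ→ℚ (n !))) ⟩
    B * (½ * inv (ℕ→ℚ (n !)))     ≡⟨ solve 2 (λ b i → b :* (con ½ :* i) := con ½ :* (b :* i)) refl B (inv (ℕ→ℚ (n !))) ⟩
    ½ * (B * inv (ℕ→ℚ (n !)))     ≡⟨ cong (½ *_) (bernoulliPoly-÷-! l n) ⟩
    ½ * (H ^S l) n                ∎)
    where
    n = l ∸ 1
    B = bernoulliPoly l n (ℕ→ℚ l * ½)

  𝒞*-even : ∀ l → l % 2 ≡ 0 → 𝒞* l ≡ evenCoeff l ·π^ -[1+ 0 ]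
  𝒞*-even l l-even rewrite l-even = cong (_·π^ -[1+ 0 ]) (begin
    sgn (suc (l / 2)) * ½ * (bernoulliPoly l n (ℕ→ℚ l * ½) * inv (ℕ→ℚ (n !)))  ≡⟨ ℚP.*-assoc (sgn (suc (l / 2))) ½ _ ⟩
    sgn (suc (l / 2)) * (½ * (bernoulliPoly l n (ℕ→ℚ l * ½) * inv (ℕ→ℚ (n !)))) ≡⟨ cong (λ x → sgn (suc (l / 2)) * (½ * x)) (bernoulliPoly-÷-! l n) ⟩
    evenCoeff l                                                                ∎)
    where
    n = l ∸ 2

  -- sgn (k + 1) = − sgn k is what turns the minus sign of H^-coeff-step into the same recurrence as for 𝒞.
  sgn-step : ∀ s u v c c′ → u * c′ ≡ - (¼ * (v * c)) → (ℕ→ℚ 4 * u) * ((- 1ℚ * s) * (½ * c′)) ≡ v * (s * (½ * c))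
  sgn-step s u v c c′ uc′≡ = begin
    (ℕ→ℚ 4 * u) * ((- 1ℚ * s) * (½ * c′))   ≡⟨ solve 3 (λ u s c′ → (con (ℕ→ℚ 4) :* u) :* ((:- con 1ℚ :* s) :* (con ½ :* c′)) := (:- con (ℕ→ℚ 2) :* s) :* (u :* c′)) refl u s c′ ⟩
    (- ℕ→ℚ 2 * s) * (u * c′)                ≡⟨ cong ((- ℕ→ℚ 2 * s) *_) uc′≡ ⟩
    (- ℕ→ℚ 2 * s) * - (¼ * (v * c))         ≡⟨ solve 3 (λ s v c → (:- con (ℕ→ℚ 2) :* s) :* (:- (con ¼ :* (v :* c))) := v :* (s :* (con ½ :* c))) refl s v c ⟩
    v * (s * (½ * c))                       ∎

  /2-step : ∀ m → (2 ℕ.+ m) / 2 ≡ suc (m / 2)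
  /2-step m = ℕD.m/n≡1+[m∸n]/n {2 ℕ.+ m} {2} (s≤s (s≤s z≤n))

  oddCoeff-step : ∀ j → (ℕ→ℚ 4 * ℕ→ℚ (2 ℕ.+ j)) * oddCoeff (3 ℕ.+ j) ≡ ℕ→ℚ (suc j) * oddCoeff (suc j)
  oddCoeff-step j rewrite /2-step j =
    sgn-step (sgn (j / 2)) (ℕ→ℚ (2 ℕ.+ j)) (ℕ→ℚ (suc j)) ((H ^S suc j) j) ((H ^S (3 ℕ.+ j)) (2 ℕ.+ j))
             (H^-coeff-step j j (inj₂ refl))

  evenCoeff-step : ∀ m → (ℕ→ℚ 4 * ℕ→ℚ (3 ℕ.+ m)) * evenCoeff (4 ℕ.+ m) ≡ ℕ→ℚ (2 ℕ.+ m) * evenCoeff (2 ℕ.+ m)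
  evenCoeff-step m rewrite /2-step (2 ℕ.+ m) =
    sgn-step (sgn (suc ((2 ℕ.+ m) / 2))) (ℕ→ℚ (3 ℕ.+ m)) (ℕ→ℚ (2 ℕ.+ m)) ((H ^S (2 ℕ.+ m)) m) ((H ^S (4 ℕ.+ m)) (2 ℕ.+ m))
             (H^-coeff-step (suc m) m (inj₁ refl))

  𝒞*-recurrent : Recurrent 𝒞*
  𝒞*-recurrent = record { coeff-step = coeff-step ; piExp-step = piExp-step }
    where
    coeff-step : ∀ j → (ℕ→ℚ 4 * ℕ→ℚ (2 ℕ.+ j)) * coeff (𝒞* (3 ℕ.+ j)) ≡ ℕ→ℚ (suc j) * coeff (𝒞* (suc j))
    coeff-step j with parity (suc j)
    coeff-step j | inj₂ odd = begin
      (ℕ→ℚ 4 * ℕ→ℚ (2 ℕ.+ j)) * coeff (𝒞* (3 ℕ.+ j))   ≡⟨ cong (λ c → (ℕ→ℚ 4 * ℕ→ℚ (2 ℕ.+ j)) * coeff c) (𝒞*-odd (3 ℕ.+ j) odd) ⟩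
      (ℕ→ℚ 4 * ℕ→ℚ (2 ℕ.+ j)) * oddCoeff (3 ℕ.+ j)     ≡⟨ oddCoeff-step j ⟩
      ℕ→ℚ (suc j) * oddCoeff (suc j)                   ≡⟨ cong (λ c → ℕ→ℚ (suc j) * coeff c) (𝒞*-odd (suc j) odd) ⟨
      ℕ→ℚ (suc j) * coeff (𝒞* (suc j))                 ∎
    coeff-step (suc m) | inj₁ even = begin
      (ℕ→ℚ 4 * ℕ→ℚ (3 ℕ.+ m)) * coeff (𝒞* (4 ℕ.+ m))   ≡⟨ cong (λ c → (ℕ→ℚ 4 * ℕ→ℚ (3 ℕ.+ m)) * coeff c) (𝒞*-even (4 ℕ.+ m) even) ⟩
      (ℕ→ℚ 4 * ℕ→ℚ (3 ℕ.+ m)) * evenCoeff (4 ℕ.+ m)    ≡⟨ evenCoeff-step m ⟩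
      ℕ→ℚ (2 ℕ.+ m) * evenCoeff (2 ℕ.+ m)              ≡⟨ cong (λ c → ℕ→ℚ (2 ℕ.+ m) * coeff c) (𝒞*-even (2 ℕ.+ m) even) ⟨
      ℕ→ℚ (2 ℕ.+ m) * coeff (𝒞* (2 ℕ.+ m))             ∎

    piExp-step : ∀ j → piExp (𝒞* (3 ℕ.+ j)) ≡ piExp (𝒞* (suc j))
    piExp-step j with parity (suc j)
    ... | inj₂ odd = trans (cong piExp (𝒞*-odd (3 ℕ.+ j) odd)) (sym (cong piExp (𝒞*-odd (suc j) odd)))
    ... | inj₁ even = trans (cong piExp (𝒞*-even (3 ℕ.+ j) even)) (sym (cong piExp (𝒞*-even (suc j) even)))

propositionA1 : (ℓ : ℕ) → ℓ ≥ 1 → 𝒞 ℓ ≡ 𝒞* ℓ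
propositionA1 (suc j) _ = Recurrent-unique 𝒞-recurrent 𝒞*-recurrent refl refl j
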